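{- There is a faithful functor $\mathbf{Rel}\to\mathcal{G}$ which is the identity (in particular surjective) on objects, whose action on morphisms sends a relation $R: A\to B$ (i.e. $R\subseteq A\times B$) to the complete graph with vertex set $R$.
   Context: $\mathbf{Rel}$ is the category of sets and binary relations. A graph is a vertex set $W$ with a set $E$ of unordered pairs $\{v,w\}$ of vertices ($v=w$ allowed) such that $\{v\}\in E$ for every $v\in W$; it is complete if every pair of vertices is an edge. The category $\mathcal{G}$ has sets as objects; a morphism $\gamma: A\to B$ is a graph whose vertex set is a subset of $A\times B$; composition of $\gamma: A\to B$, $\gamma': B\to C$: $V(\gamma'\circ\gamma)=\{(a,c)\mid\exists b.\ (a,b)\in V(\gamma)\wedge(b,c)\in V(\gamma')\}$, $E(\gamma'\circ\gamma)=\{\{(a,c),(a',c')\}\mid\exists b,b'.\ \{(a,b),(a',b')\}\in E(\gamma)\wedge\{(b,c),(b',c')\}\in E(\gamma')\}$; identity $1_A$ is the complete graph on $\{(a,a)\mid a\in A\}$. -}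

module Defs where

open import Level using (Level; suc)
open import Data.Product using (Σ; ∃; _×_; _,_; proj₁; proj₂)
open import Relation.Binary.PropositionalEquality using (_≡_; refl; sym; trans)
open import Function.Bundles using (_⇔_)

-- Subsets are predicates; two subsets are equal when they have the same
-- elements (pointwise logical equivalence).

Rel : ∀ {ℓ} → Set ℓ → Set ℓ → Set (suc ℓ)
Rel {ℓ} A B = A → B → Set ℓ

idR : ∀ {ℓ} {A : Set ℓ} → Rel A A
idR a a' = a ≡ a'

_∘R_ : ∀ {ℓ} {A B C : Set ℓ} → Rel B C → Rel A B → Rel A C
_∘R_ {B = B} S R a c = Σ B λ b → R a b × S b c

_≈R_ : ∀ {ℓ} {A B : Set ℓ} → Rel A B → Rel A B → Set ℓ
R ≈R S = ∀ a b → R a b ⇔ S a b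

-- Graphs: a vertex subset V of X and a set E of unordered pairs of
-- vertices (an unordered pair {v,w} is represented by a symmetric
-- relation E v w), containing every loop {v} for v ∈ V.

record Graph {ℓ} (X : Set ℓ) : Set (suc ℓ) where
  field
    V     : X → Set ℓ
    E     : X → X → Set ℓ
    E-sym : ∀ {x y} → E x y → E y x
    E-V   : ∀ {x y} → E x y → V x
    E-rfl : ∀ {x} → V x → E x x
open Graph public

complete : ∀ {ℓ} {X : Set ℓ} → (X → Set ℓ) → Graph X
complete P = record
  { V = P
  ; E = λ x y → P x × P y
  ; E-sym = λ { (p , q) → q , p }
  ; E-V = proj₁
  ; E-rfl = λ p → p , p
  }

Hom𝒢 : ∀ {ℓ} → Set ℓ → Set ℓ → Set (suc ℓ)
Hom𝒢 A B = Graph (A × B)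

id𝒢 : ∀ {ℓ} {A : Set ℓ} → Hom𝒢 A A
id𝒢 = complete λ { (a , a') → a ≡ a' }

_∘𝒢_ : ∀ {ℓ} {A B C : Set ℓ} → Hom𝒢 B C → Hom𝒢 A B → Hom𝒢 A C
_∘𝒢_ {B = B} γ' γ = record
  { V = λ { (a , c) → Σ B λ b → V γ (a , b) × V γ' (b , c) }
  ; E = λ { (a , c) (a' , c') → Σ B λ b → Σ B λ b' →
              E γ (a , b) (a' , b') × E γ' (b , c) (b' , c') }
  ; E-sym = λ { (b , b' , e , e') → b' , b , E-sym γ e , E-sym γ' e' }
  ; E-V = λ { (b , b' , e , e') → b , E-V γ e , E-V γ' e' }
  ; E-rfl = λ { (b , v , v') → b , b , E-rfl γ v , E-rfl γ' v' }
  }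

_≈𝒢_ : ∀ {ℓ} {A B : Set ℓ} → Hom𝒢 A B → Hom𝒢 A B → Set ℓ
γ ≈𝒢 δ = (∀ p → V γ p ⇔ V δ p) × (∀ p q → E γ p q ⇔ E δ p q)

F₁ : ∀ {ℓ} {A B : Set ℓ} → Rel A B → Hom𝒢 A B
F₁ R = complete λ { (a , b) → R a b }

IsFaithfulFunctor : ∀ ℓ → Set (suc ℓ)
IsFaithfulFunctor ℓ =
    (∀ {A B : Set ℓ} (R S : Rel A B) → R ≈R S → F₁ R ≈𝒢 F₁ S)
  ×
    (∀ {A : Set ℓ} → F₁ (idR {A = A}) ≈𝒢 id𝒢)
  ×
    (∀ {A B C : Set ℓ} (R : Rel A B) (S : Rel B C) →
       F₁ (S ∘R R) ≈𝒢 (F₁ S ∘𝒢 F₁ R))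
  ×
    (∀ {A B : Set ℓ} (R S : Rel A B) → F₁ R ≈𝒢 F₁ S → R ≈R S)

module Submission where

-- The point is that an
--     edge of the composite may use two independent intermediate witnesses b, b',
--     so every pair of composite vertices is joined;
--   * `complete-injective`: a complete graph determines its vertex subset.

open import Data.Product using (Σ; _×_; _,_; proj₁)
open import Data.Product.Function.NonDependent.Propositional using (_×-⇔_)
open import Function.Bundles using (_⇔_; mk⇔)
open import Function.Construct.Identity using (⇔-id)
open import Defs

≈𝒢-refl : ∀ {ℓ} {A B : Set ℓ} (γ : Hom𝒢 A B) → γ ≈𝒢 γ
≈𝒢-refl γ = (λ p → ⇔-id (V γ p)) , (λ p q → ⇔-id (E γ p q))

complete-cong : ∀ {ℓ} {A B : Set ℓ} {P Q : A × B → Set ℓ} →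
                (∀ p → P p ⇔ Q p) → complete P ≈𝒢 complete Q
complete-cong P⇔Q = P⇔Q , λ p q → P⇔Q p ×-⇔ P⇔Q q

complete-injective : ∀ {ℓ} {A B : Set ℓ} {P Q : A × B → Set ℓ} →
                     complete P ≈𝒢 complete Q → ∀ p → P p ⇔ Q p
complete-injective = proj₁

_⨾_ : ∀ {ℓ} {A B C : Set ℓ} → (A × B → Set ℓ) → (B × C → Set ℓ) → (A × C → Set ℓ)
_⨾_ {B = B} P Q (a , c) = Σ B λ b → P (a , b) × Q (b , c)

-- An edge {(a,c),(a',c')} of the complete graph consists
-- of witnesses b for (a,c) and b' for (a',c'); these are exactly the data of an
-- edge of the 𝒢-composite, with {(a,b),(a',b')} and {(b,c),(b',c')} edges of
-- the respective complete graphs.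
complete-∘ : ∀ {ℓ} {A B C : Set ℓ} (P : A × B → Set ℓ) (Q : B × C → Set ℓ) →
             complete (P ⨾ Q) ≈𝒢 (complete Q ∘𝒢 complete P)
complete-∘ P Q =
    (λ p → ⇔-id ((P ⨾ Q) p))
  , λ { (a , c) (a' , c') → mk⇔
        (λ { ((b , p , q) , (b' , p' , q')) → b , b' , (p , p') , (q , q') })
        (λ { (b , b' , (p , p') , (q , q')) → (b , p , q) , (b' , p' , q') }) }

proposition5p7 : ∀ ℓ → IsFaithfulFunctor ℓ
proposition5p7 ℓ = respects-≈ , preserves-id , preserves-∘ , faithful
  where
  respects-≈ : ∀ {A B : Set ℓ} (R S : Rel A B) → R ≈R S → F₁ R ≈𝒢 F₁ S
  respects-≈ R S R≈S = complete-cong λ { (a , b) → R≈S a b }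

  preserves-id : ∀ {A : Set ℓ} → F₁ (idR {A = A}) ≈𝒢 id𝒢
  preserves-id = ≈𝒢-refl id𝒢

  preserves-∘ : ∀ {A B C : Set ℓ} (R : Rel A B) (S : Rel B C) →
                F₁ (S ∘R R) ≈𝒢 (F₁ S ∘𝒢 F₁ R)
  preserves-∘ R S = complete-∘ (λ { (a , b) → R a b }) (λ { (b , c) → S b c })

  faithful : ∀ {A B : Set ℓ} (R S : Rel A B) → F₁ R ≈𝒢 F₁ S → R ≈R S
  faithful R S FR≈FS a b = complete-injective FR≈FS (a , b)
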